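{- Let $M$ be a monoid, $\equiv_1$ and $\equiv_2$ two clone congruences of $\mathbf{P}(M)$, and $\mathbb{P}_{\equiv_1}$, $\mathbb{P}_{\equiv_2}$ $\mathbb{P}$-symbols for $\equiv_1$ and $\equiv_2$ respectively. Suppose $\mathbb{P}_{\equiv_1}\circ\mathbb{P}_{\equiv_2}=\mathbb{P}_{\equiv_2}\circ\mathbb{P}_{\equiv_1}$, denote this map $\mathbb{P}_{12}$, and let $\equiv$ be the fiber equivalence relation of $\mathbb{P}_{12}$. Then (i) $\mathbb{P}_{12}$ is a $\mathbb{P}$-symbol for $\equiv$; (ii) $\equiv$ is a clone congruence of $\mathbf{P}(M)$; (iii) the clone $\mathbf{P}(M)/_\equiv$ is a quotient of both $\mathbf{P}(M)/_{\equiv_1}$ and $\mathbf{P}(M)/_{\equiv_2}$.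
   Context: For a monoid $(M,\cdot,e)$: an $M$-pigmented letter is a pair $i^\alpha$ ($i\ge1$ an integer, $\alpha\in M$); $\mathbf{P}(M)(n)$ is the set of words of $M$-pigmented letters with values in $[n]$. For $\alpha\in M$, $\alpha\odot i_1^{\alpha_1}\cdots i_\ell^{\alpha_\ell}:=i_1^{\alpha\cdot\alpha_1}\cdots i_\ell^{\alpha\cdot\alpha_\ell}$. The clone $\mathbf{P}(M)$ has superposition $i_1^{\alpha_1}\cdots i_\ell^{\alpha_\ell}[\mathfrak{p}_1,\dots,\mathfrak{p}_n]:=(\alpha_1\odot\mathfrak{p}_{i_1})\cdots(\alpha_\ell\odot\mathfrak{p}_{i_\ell})$ and projections $i^e$. A clone congruence is an arity-preserving equivalence relation compatible with superposition; $\mathbf{P}(M)/_\equiv$ is the quotient clone. A $\mathbb{P}$-symbol for an equivalence relation $\equiv$ is an (arity-preserving) map $\mathbb{P}:\mathbf{P}(M)\to\mathbf{P}(M)$ such that $\mathfrak{p}\equiv\mathbb{P}(\mathfrak{p})$ for all $\mathfrak{p}$, and $\mathfrak{p}\equiv\mathfrak{p}'$ implies $\mathbb{P}(\mathfrak{p})=\mathbb{P}(\mathfrak{p}')$. The fiber equivalence relation of a map $\mathbb{P}$ relates $\mathfrak{p},\mathfrak{p}'$ whenever $\mathbb{P}(\mathfrak{p})=\mathbb{P}(\mathfrak{p}')$. A clone $D$ is a quotient of a clone $C$ if there is a surjective clone morphism $C\to D$. -}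

module Defs where

open import Level using (Level; _⊔_) renaming (suc to lsuc)
open import Algebra.Core using (Op₂)
open import Algebra.Structures using (IsMonoid)
open import Data.Nat using (ℕ)
open import Data.Fin using (Fin)
open import Data.Product using (_×_; _,_; Σ; ∃)
open import Data.List using (List; []; _∷_; _++_)
open import Data.List.Properties using (++-assoc; ++-identityʳ)
open import Function using (_∘_)
open import Relation.Binary.Core using (Rel)
open import Relation.Binary.Structures using (IsEquivalence)
open import Relation.Binary.PropositionalEquality
  using (_≡_; refl; cong; cong₂; subst; sym; trans)

record Clone (c ℓ : Level) : Set (lsuc (c ⊔ ℓ)) where
  infixl 10 _[_]
  field
    Carrier       : ℕ → Set c
    _≈_           : ∀ {n} → Rel (Carrier n) ℓ
    isEquivalence : ∀ {n} → IsEquivalence (_≈_ {n})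
    _[_]          : ∀ {n m} → Carrier n → (Fin n → Carrier m) → Carrier m
    proj          : ∀ {n} → Fin n → Carrier n
    []-cong       : ∀ {n m} {x x' : Carrier n} {ys ys' : Fin n → Carrier m} →
                    x ≈ x' → (∀ i → ys i ≈ ys' i) → (x [ ys ]) ≈ (x' [ ys' ])
    assoc         : ∀ {n m k} (x : Carrier n) (ys : Fin n → Carrier m)
                    (zs : Fin m → Carrier k) →
                    ((x [ ys ]) [ zs ]) ≈ (x [ (λ i → ys i [ zs ]) ])
    proj-left     : ∀ {n m} (i : Fin n) (ys : Fin n → Carrier m) →
                    (proj i [ ys ]) ≈ ys i
    proj-right    : ∀ {n} (x : Carrier n) → (x [ proj ]) ≈ x

record CloneMorphism {c₁ ℓ₁ c₂ ℓ₂} (C : Clone c₁ ℓ₁) (D : Clone c₂ ℓ₂)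
       : Set (c₁ ⊔ ℓ₁ ⊔ c₂ ⊔ ℓ₂) where
  private
    module C = Clone C
    module D = Clone D
  field
    ⟦_⟧      : ∀ {n} → C.Carrier n → D.Carrier n
    ⟦⟧-cong  : ∀ {n} {x y : C.Carrier n} → x C.≈ y → ⟦ x ⟧ D.≈ ⟦ y ⟧
    hom-[]   : ∀ {n m} (x : C.Carrier n) (ys : Fin n → C.Carrier m) →
               ⟦ x C.[ ys ] ⟧ D.≈ (⟦ x ⟧ D.[ ⟦_⟧ ∘ ys ])
    hom-proj : ∀ {n} (i : Fin n) → ⟦ C.proj i ⟧ D.≈ D.proj i

IsQuotientOf : ∀ {c₁ ℓ₁ c₂ ℓ₂} (D : Clone c₂ ℓ₂) (C : Clone c₁ ℓ₁) →
               Set (c₁ ⊔ ℓ₁ ⊔ c₂ ⊔ ℓ₂)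
IsQuotientOf D C =
  Σ (CloneMorphism C D) λ φ →
    ∀ {n} (y : Clone.Carrier D n) →
      ∃ λ x → Clone._≈_ D (CloneMorphism.⟦_⟧ φ x) y

module Pigmented {a} (M : Set a) (_∙_ : Op₂ M) (e : M) where

  -- a pigmented letter i^α with i ∈ [n] (represented by Fin n)
  Letter : ℕ → Set a
  Letter n = Fin n × M

  Word : ℕ → Set a
  Word n = List (Letter n)

  infixr 20 _⊙_
  _⊙_ : ∀ {n} → M → Word n → Word n
  α ⊙ []            = []
  α ⊙ ((i , β) ∷ w) = (i , α ∙ β) ∷ (α ⊙ w)

  infixl 10 _[_]
  _[_] : ∀ {n m} → Word n → (Fin n → Word m) → Word m
  []            [ qs ] = []
  ((i , α) ∷ w) [ qs ] = (α ⊙ qs i) ++ (w [ qs ])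

  proj : ∀ {n} → Fin n → Word n
  proj i = (i , e) ∷ []

  GradedRel : (ℓ : Level) → Set (a ⊔ lsuc ℓ)
  GradedRel ℓ = ∀ n → Rel (Word n) ℓ

  record IsCloneCongruence {ℓ} (R : GradedRel ℓ) : Set (a ⊔ ℓ) where
    field
      isEquivalence : ∀ n → IsEquivalence (R n)
      compatible    : ∀ {n m} {p p' : Word n} {qs qs' : Fin n → Word m} →
                      R n p p' → (∀ i → R m (qs i) (qs' i)) →
                      R m (p [ qs ]) (p' [ qs' ])

  WordMap : Set a
  WordMap = ∀ {n} → Word n → Word n

  IsPSymbol : ∀ {ℓ} → GradedRel ℓ → WordMap → Set (a ⊔ ℓ)
  IsPSymbol R P =
    (∀ {n} (p : Word n) → R n p (P p)) ×
    (∀ {n} (p p' : Word n) → R n p p' → P p ≡ P p')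

  Fiber : WordMap → GradedRel a
  Fiber P n p p' = P p ≡ P p'

  module Laws (isMonoid : IsMonoid _≡_ _∙_ e) where
    open IsMonoid isMonoid using (identityˡ; identityʳ) renaming (assoc to ∙-assoc)

    ⊙-++ : ∀ {n} α (u v : Word n) → α ⊙ (u ++ v) ≡ (α ⊙ u) ++ (α ⊙ v)
    ⊙-++ α []            v = refl
    ⊙-++ α ((i , β) ∷ u) v = cong ((i , α ∙ β) ∷_) (⊙-++ α u v)

    ⊙-⊙ : ∀ {n} α β (w : Word n) → α ⊙ (β ⊙ w) ≡ (α ∙ β) ⊙ w
    ⊙-⊙ α β [] = refl
    ⊙-⊙ α β ((i , γ) ∷ w) =
      cong₂ (λ x y → (i , x) ∷ y) (sym (∙-assoc α β γ)) (⊙-⊙ α β w)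

    ⊙-e : ∀ {n} (w : Word n) → e ⊙ w ≡ w
    ⊙-e [] = refl
    ⊙-e ((i , β) ∷ w) = cong₂ (λ x y → (i , x) ∷ y) (identityˡ β) (⊙-e w)

    ⊙-[] : ∀ {n m} α (w : Word n) (qs : Fin n → Word m) →
           α ⊙ (w [ qs ]) ≡ (α ⊙ w) [ qs ]
    ⊙-[] α [] qs = refl
    ⊙-[] α ((i , β) ∷ w) qs =
      trans (⊙-++ α (β ⊙ qs i) (w [ qs ]))
            (cong₂ _++_ (⊙-⊙ α β (qs i)) (⊙-[] α w qs))

    ++-[] : ∀ {n m} (u v : Word n) (qs : Fin n → Word m) →
            (u ++ v) [ qs ] ≡ (u [ qs ]) ++ (v [ qs ])
    ++-[] [] v qs = refl
    ++-[] ((i , α) ∷ u) v qs =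
      trans (cong ((α ⊙ qs i) ++_) (++-[] u v qs))
            (sym (++-assoc (α ⊙ qs i) (u [ qs ]) (v [ qs ])))

    []-assoc : ∀ {n m k} (w : Word n) (ys : Fin n → Word m) (zs : Fin m → Word k) →
               (w [ ys ]) [ zs ] ≡ w [ (λ i → ys i [ zs ]) ]
    []-assoc [] ys zs = refl
    []-assoc ((i , α) ∷ w) ys zs =
      trans (++-[] (α ⊙ ys i) (w [ ys ]) zs)
            (cong₂ _++_ (sym (⊙-[] α (ys i) zs)) ([]-assoc w ys zs))

    []-proj-left : ∀ {n m} (i : Fin n) (ys : Fin n → Word m) → proj i [ ys ] ≡ ys i
    []-proj-left i ys = trans (++-identityʳ (e ⊙ ys i)) (⊙-e (ys i))

    []-proj-right : ∀ {n} (w : Word n) → w [ proj ] ≡ w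
    []-proj-right [] = refl
    []-proj-right ((i , α) ∷ w) =
      cong₂ (λ x y → (i , x) ∷ y) (identityʳ α) ([]-proj-right w)

  Quotient : ∀ {ℓ} → IsMonoid _≡_ _∙_ e → (R : GradedRel ℓ) →
             IsCloneCongruence R → Clone a ℓ
  Quotient isMonoid R cong' = record
    { Carrier       = Word
    ; _≈_           = λ {n} → R n
    ; isEquivalence = λ {n} → isEquivalence n
    ; _[_]          = _[_]
    ; proj          = proj
    ; []-cong       = compatible
    ; assoc         = λ x ys zs → ≡⇒R ([]-assoc x ys zs)
    ; proj-left     = λ i ys → ≡⇒R ([]-proj-left i ys)
    ; proj-right    = λ x → ≡⇒R ([]-proj-right x)
    }
    where
      open IsCloneCongruence cong'
      open Laws isMonoid
      ≡⇒R : ∀ {n} {x y : Word n} → x ≡ y → R n x y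
      ≡⇒R {n} {x} refl = IsEquivalence.refl (isEquivalence n)

{-# OPTIONS --safe #-}
-- The composite P = P₁ ∘ P₂ is idempotent, so it is a P-symbol for its own fiber relation.
-- Both R₁ and R₂ lie inside that fiber (for R₁ thanks to commutation), so within the fiber
-- one may replace a superposition first by P₂-normal forms and then by P₁-normal forms of all
-- its pieces; hence P (p [ qs ]) only depends on P p and the P (qs i), which makes the fiber a
-- clone congruence. Being coarser than R₁ and R₂, it is the target of the identity morphisms.
module Submission where

open import Defs
open import Algebra.Core using (Op₂)
open import Algebra.Structures using (IsMonoid)
open import Data.Product using (_×_; Σ; _,_)
open import Data.Fin using (Fin)
open import Data.List using (_∷_; []; _++_)
open import Function using (id; _∘_)
open import Relation.Binary.Core using (_⇒_)
open import Relation.Binary.Structures using (IsEquivalence)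
open import Relation.Binary.PropositionalEquality
  using (_≡_; _≗_; refl; cong; cong₂; sym; trans)
open Relation.Binary.PropositionalEquality.≡-Reasoning

module PSymbols {a} (M : Set a) (_∙_ : Op₂ M) (e : M) where
  open Pigmented M _∙_ e

  Idempotent : WordMap → Set a
  Idempotent P = ∀ {n} (p : Word n) → P p ≡ P (P p)

  PSymbol⇒idempotent : ∀ {ℓ} {R : GradedRel ℓ} {P : WordMap} →
                       IsPSymbol R P → Idempotent P
  PSymbol⇒idempotent (related , constant) p = constant p _ (related p)

  idempotent⇒PSymbol-Fiber : ∀ {P : WordMap} → Idempotent P → IsPSymbol (Fiber P) P
  idempotent⇒PSymbol-Fiber idem = idem , λ _ _ → id

  ∘-idempotent : ∀ {P₁ P₂ : WordMap} → Idempotent P₁ → Idempotent P₂ →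
                 (∀ {n} (p : Word n) → P₁ (P₂ p) ≡ P₂ (P₁ p)) →
                 Idempotent (P₁ ∘ P₂)
  ∘-idempotent {P₁} {P₂} idem₁ idem₂ comm p = begin
    P₁ (P₂ p)                 ≡⟨ cong P₁ (idem₂ p) ⟩
    P₁ (P₂ (P₂ p))            ≡⟨ idem₁ (P₂ (P₂ p)) ⟩
    P₁ (P₁ (P₂ (P₂ p)))       ≡⟨ cong P₁ (comm (P₂ p)) ⟩
    P₁ (P₂ (P₁ (P₂ p)))       ∎

  Fiber-∘-comm : ∀ {P₁ P₂ : WordMap} →
                 (∀ {n} (p : Word n) → P₁ (P₂ p) ≡ P₂ (P₁ p)) →
                 ∀ {n} → Fiber P₁ n ⇒ Fiber (P₁ ∘ P₂) n
  Fiber-∘-comm {P₁} {P₂} comm {x = p} {p'} eq = begin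
    P₁ (P₂ p)   ≡⟨ comm p ⟩
    P₂ (P₁ p)   ≡⟨ cong P₂ eq ⟩
    P₂ (P₁ p')  ≡⟨ comm p' ⟨
    P₁ (P₂ p')  ∎

  Fiber-isEquivalence : ∀ (P : WordMap) n → IsEquivalence (Fiber P n)
  Fiber-isEquivalence P n = record { refl = refl ; sym = sym ; trans = trans }

  []-congʳ : ∀ {n m} (p : Word n) {qs qs' : Fin n → Word m} → qs ≗ qs' → p [ qs ] ≡ p [ qs' ]
  []-congʳ []            eqs = refl
  []-congʳ ((i , α) ∷ p) eqs = cong₂ (λ q r → (α ⊙ q) ++ r) (eqs i) ([]-congʳ p eqs)

  Fiber-[]-normalize : ∀ {ℓ} {R : GradedRel ℓ} {P Q : WordMap} →
                       IsCloneCongruence R → (∀ {n} → R n ⇒ Fiber P n) →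
                       (∀ {n} (p : Word n) → R n p (Q p)) →
                       ∀ {n m} (p : Word n) (qs : Fin n → Word m) →
                       P (p [ qs ]) ≡ P (Q p [ Q ∘ qs ])
  Fiber-[]-normalize c R⊆Fiber related p qs =
    R⊆Fiber (IsCloneCongruence.compatible c (related p) (related ∘ qs))

  Fiber-isCloneCongruence : ∀ {P : WordMap} →
                            (∀ {n m} (p : Word n) (qs : Fin n → Word m) →
                               P (p [ qs ]) ≡ P (P p [ P ∘ qs ])) →
                            IsCloneCongruence (Fiber P)
  Fiber-isCloneCongruence {P} normalize = record
    { isEquivalence = Fiber-isEquivalence P
    ; compatible    = λ {_} {_} {p} {p'} {qs} {qs'} eq eqs → begin
        P (p [ qs ])             ≡⟨ normalize p qs ⟩
        P (P p [ P ∘ qs ])       ≡⟨ cong P (trans (cong (_[ P ∘ qs ]) eq) ([]-congʳ (P p') eqs)) ⟩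
        P (P p' [ P ∘ qs' ])     ≡⟨ normalize p' qs' ⟨
        P (p' [ qs' ])           ∎
    }

  IsQuotientOf-coarser : ∀ {ℓ ℓ'} (isMonoid : IsMonoid _≡_ _∙_ e)
                         {R : GradedRel ℓ} {S : GradedRel ℓ'}
                         (cR : IsCloneCongruence R) (cS : IsCloneCongruence S) →
                         (∀ {n} → R n ⇒ S n) →
                         IsQuotientOf (Quotient isMonoid S cS) (Quotient isMonoid R cR)
  IsQuotientOf-coarser isMonoid {S = S} cR cS R⊆S =
    record { ⟦_⟧ = id ; ⟦⟧-cong = R⊆S ; hom-[] = λ _ _ → S-refl ; hom-proj = λ _ → S-refl }
    , λ y → y , S-refl
    where
      S-refl : ∀ {n} {p : Word n} → S n p p
      S-refl {n} = IsEquivalence.refl (IsCloneCongruence.isEquivalence cS n)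

proposition4p1p4 : ∀ {a ℓ₁ ℓ₂} (M : Set a) (_∙_ : Op₂ M) (e : M) (isMonoid : IsMonoid _≡_ _∙_ e) →
    let open Pigmented M _∙_ e in
    (R₁ : GradedRel ℓ₁) (R₂ : GradedRel ℓ₂) (c₁ : IsCloneCongruence R₁) (c₂ : IsCloneCongruence R₂) →
    (P₁ P₂ : WordMap) → IsPSymbol R₁ P₁ → IsPSymbol R₂ P₂ →
    (∀ {n} (p : Word n) → P₁ (P₂ p) ≡ P₂ (P₁ p)) →
    IsPSymbol (Fiber (λ p → P₁ (P₂ p))) (λ p → P₁ (P₂ p)) ×
    Σ (IsCloneCongruence (Fiber (λ p → P₁ (P₂ p)))) (λ c →
      IsQuotientOf (Quotient isMonoid (Fiber (λ p → P₁ (P₂ p))) c) (Quotient isMonoid R₁ c₁) ×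
      IsQuotientOf (Quotient isMonoid (Fiber (λ p → P₁ (P₂ p))) c) (Quotient isMonoid R₂ c₂))
proposition4p1p4 M _∙_ e isMonoid R₁ R₂ c₁ c₂ P₁ P₂
                 symbol₁@(related₁ , constant₁) symbol₂@(related₂ , constant₂) comm =
  idempotent⇒PSymbol-Fiber (∘-idempotent (PSymbol⇒idempotent symbol₁) (PSymbol⇒idempotent symbol₂) comm)
  , congruence
  , IsQuotientOf-coarser isMonoid c₁ congruence R₁⊆Fiber
  , IsQuotientOf-coarser isMonoid c₂ congruence R₂⊆Fiber
  where
    open Pigmented M _∙_ e
    open PSymbols M _∙_ e

    R₁⊆Fiber : ∀ {n} → R₁ n ⇒ Fiber (P₁ ∘ P₂) n
    R₁⊆Fiber {x = p} {p'} = Fiber-∘-comm {P₁} {P₂} comm ∘ constant₁ p p'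

    R₂⊆Fiber : ∀ {n} → R₂ n ⇒ Fiber (P₁ ∘ P₂) n
    R₂⊆Fiber {x = p} {p'} = cong P₁ ∘ constant₂ p p'

    congruence : IsCloneCongruence (Fiber (P₁ ∘ P₂))
    congruence = Fiber-isCloneCongruence λ p qs →
      trans (Fiber-[]-normalize c₂ R₂⊆Fiber related₂ p qs)
            (Fiber-[]-normalize c₁ R₁⊆Fiber related₁ (P₂ p) (P₂ ∘ qs))
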